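{- Let $\mathcal{H}$ be a set of graphs and $G$ a critically $\mathcal{H}$-exist graph. Let $S\subseteq V(G)$ be such that $G[S]$ is isomorphic to a graph in $\mathcal{H}$. Then no vertex $x\in V(G)\setminus S$ satisfies any of the following: $N(x)$ consists of exactly one vertex; $N(x)$ consists of exactly two adjacent vertices; $N(x)$ consists of exactly three vertices inducing $P_3$ or $C_3$; $x$ is adjacent to a vertex of degree $|V(G)|-1$.
   Context: All graphs are finite and simple. A graph is $\mathcal{H}$-free if none of its induced subgraphs is isomorphic to a graph in $\mathcal{H}$, and $\mathcal{H}$-exist otherwise. For an edge $e=uv$, $G/e$ is obtained by deleting $u,v$ and adding a new vertex adjacent to every vertex of $(N(u)\cup N(v))\setminus\{u,v\}$. $G$ is critically $\mathcal{H}$-exist if it is $\mathcal{H}$-exist and $G/e$ is $\mathcal{H}$-free for every $e\in E(G)$. $P_3$ is the path on three vertices and $C_3$ the triangle. -}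

module Defs where

open import Data.Nat using (ℕ; zero; suc; _∸_)
open import Data.Bool using (Bool; true; false; not; _∧_; _∨_; if_then_else_)
open import Data.Bool.Properties using (∨-comm; ∨-assoc)
open import Data.Fin using (Fin; punchIn; _≟_)
open import Data.Fin.Subset using (Subset; _∈_; _∉_)
open import Data.List using (List; map; allFin)
open import Data.Nat.ListAction using (sum)
open import Data.Product using (Σ; ∃; ∃-syntax; _×_; _,_)
open import Data.Sum using (_⊎_)
open import Data.Empty using (⊥-elim)
open import Function.Definitions using (Injective)
open import Relation.Nullary using (¬_; does; yes; no)
open import Relation.Binary.PropositionalEquality using (_≡_; _≢_; refl; sym; cong)

record Graph (n : ℕ) : Set where
  field
    adj     : Fin n → Fin n → Bool
    adj-sym : ∀ x y → adj x y ≡ adj y x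
    irrefl  : ∀ x → adj x x ≡ false
open Graph public

GraphFamily : Set₁
GraphFamily = (m : ℕ) → Graph m → Set

IsInducedEmbedding : ∀ {m n} → Graph m → Graph n → (Fin m → Fin n) → Set
IsInducedEmbedding H G f =
  Injective _≡_ _≡_ f × (∀ i j → adj G (f i) (f j) ≡ adj H i j)

-- G[S] is isomorphic to H: there is an induced embedding of H into G
-- whose image is exactly S.
InducedIso : ∀ {m n} → (G : Graph n) → Subset n → Graph m → Set
InducedIso {m} {n} G S H =
  Σ (Fin m → Fin n) λ f → IsInducedEmbedding H G f
    × (∀ v → v ∈ S → ∃[ i ] f i ≡ v) × (∀ i → f i ∈ S)

InducesMember : ∀ {n} → GraphFamily → Graph n → Subset n → Set
InducesMember ℋ G S = ∃[ m ] Σ (Graph m) λ H → ℋ m H × InducedIso G S H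

HExist : ∀ {n} → GraphFamily → Graph n → Set
HExist {n} ℋ G = ∃[ S ] InducesMember ℋ G S

HFree : ∀ {n} → GraphFamily → Graph n → Set
HFree ℋ G = ¬ HExist ℋ G

-- The vertex v is deleted (vertices of G/e are Fin m, identified with
-- Fin (suc m) ∖ {v} via punchIn v), and u plays the role of the new
-- vertex, adjacent to (N(u) ∪ N(v)) ∖ {u,v}.

private
  eqb : ∀ {k} → Fin k → Fin k → Bool
  eqb a b = does (a ≟ b)

  eqb-sym : ∀ {k} (a b : Fin k) → eqb a b ≡ eqb b a
  eqb-sym a b with a ≟ b | b ≟ a
  ... | yes _ | yes _ = refl
  ... | no _  | no _  = refl
  ... | yes p | no q  = ⊥-elim (q (sym p))
  ... | no p  | yes q = ⊥-elim (p (sym q))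

  eqb-refl : ∀ {k} (a : Fin k) → eqb a a ≡ true
  eqb-refl a with a ≟ a
  ... | yes _ = refl
  ... | no p  = ⊥-elim (p refl)

  swap-lemma : ∀ (p q r : Bool) → p ∨ q ∨ r ≡ p ∨ r ∨ q
  swap-lemma true  q r = refl
  swap-lemma false q r = ∨-comm q r

contract : ∀ {m} (G : Graph (suc m)) (u v : Fin (suc m)) → adj G u v ≡ true → Graph m
contract {m} G u v _ = record { adj = A ; adj-sym = A-sym ; irrefl = A-irr }
  where
  A : Fin m → Fin m → Bool
  A a b = not (eqb a b) ∧
          (adj G (punchIn v a) (punchIn v b)
           ∨ (eqb (punchIn v a) u ∧ adj G (punchIn v b) v)
           ∨ (eqb (punchIn v b) u ∧ adj G (punchIn v a) v))

  A-sym : ∀ a b → A a b ≡ A b a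
  A-sym a b rewrite eqb-sym a b
                  | adj-sym G (punchIn v a) (punchIn v b)
                  | swap-lemma (adj G (punchIn v b) (punchIn v a))
                      (eqb (punchIn v a) u ∧ adj G (punchIn v b) v)
                      (eqb (punchIn v b) u ∧ adj G (punchIn v a) v) = refl

  A-irr : ∀ a → A a a ≡ false
  A-irr a rewrite eqb-refl a = refl

CriticallyHExist : ∀ {n} → GraphFamily → Graph n → Set
CriticallyHExist {zero}  ℋ G = HExist ℋ G
CriticallyHExist {suc m} ℋ G =
  HExist ℋ G × (∀ u v (e : adj G u v ≡ true) → HFree ℋ (contract G u v e))

degree : ∀ {n} → Graph n → Fin n → ℕ
degree {n} G x = sum (map (λ z → if adj G x z then 1 else 0) (allFin n))

NbhdSingleton : ∀ {n} → Graph n → Fin n → Set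
NbhdSingleton {n} G x =
  ∃[ y ] (∀ z → (adj G x z ≡ true → z ≡ y) × (z ≡ y → adj G x z ≡ true))

NbhdEdge : ∀ {n} → Graph n → Fin n → Set
NbhdEdge {n} G x =
  ∃[ y ] ∃[ w ] (y ≢ w × adj G y w ≡ true ×
    (∀ z → (adj G x z ≡ true → z ≡ y ⊎ z ≡ w)
         × (z ≡ y ⊎ z ≡ w → adj G x z ≡ true)))

InducesP3 : ∀ {n} → Graph n → Fin n → Fin n → Fin n → Set
InducesP3 G a b c = adj G a b ≡ true × adj G b c ≡ true × adj G a c ≡ false

InducesC3 : ∀ {n} → Graph n → Fin n → Fin n → Fin n → Set
InducesC3 G a b c = adj G a b ≡ true × adj G b c ≡ true × adj G a c ≡ true

NbhdP3orC3 : ∀ {n} → Graph n → Fin n → Set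
NbhdP3orC3 {n} G x =
  ∃[ a ] ∃[ b ] ∃[ c ] (a ≢ b × b ≢ c × a ≢ c ×
    (∀ z → (adj G x z ≡ true → z ≡ a ⊎ z ≡ b ⊎ z ≡ c)
         × (z ≡ a ⊎ z ≡ b ⊎ z ≡ c → adj G x z ≡ true))
    × (InducesP3 G a b c ⊎ InducesC3 G a b c))

AdjToDominating : ∀ {n} → Graph n → Fin n → Set
AdjToDominating {n} G x = ∃[ y ] (adj G x y ≡ true × degree G y ≡ n ∸ 1)

-- If x lies outside S and some neighbour y of x satisfies N(x) ∖ {y} ⊆ N(y),
-- then contracting xy creates no new edge: G/xy is just G − x, which still
-- contains G[S], contradicting criticality. Each of the four local
-- configurations supplies such a y (the unique neighbour, an end of the
-- edge, the middle vertex of the P₃ or C₃, the dominating vertex).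
module Submission where

open import Defs
open import Data.Nat using (ℕ; zero; suc; _+_; _∸_; _≤_; _<_; z≤n; s≤s)
open import Data.Nat.Properties using (m≤n⇒m≤1+n; <-irrefl; +-assoc; +-comm)
open import Data.Bool using (Bool; true; false; _∧_; if_then_else_)
open import Data.Bool.Properties using (¬-not)
open import Data.Fin using (Fin; zero; suc; punchIn; punchOut; _≟_)
open import Data.Fin.Properties
  using (punchInᵢ≢i; punchIn-injective; punchOut-injective; punchIn-punchOut; punchOut-punchIn; punchOut-cong)
open import Data.Fin.Subset using (Subset; _∈_; _∉_)
open import Data.Vec using (Vec; lookup; removeAt)
open import Data.Vec.Properties using ([]=⇒lookup; lookup⇒[]=; removeAt-punchOut)
open import Data.List using (map; tabulate)
open import Data.List.Properties using (map-tabulate)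
open import Data.Nat.ListAction using (sum)
open import Data.Product using (∃-syntax; _×_; _,_; proj₁; proj₂)
open import Data.Sum using (_⊎_; inj₁; inj₂; [_,_]′)
open import Data.Empty using (⊥-elim)
open import Function using (_∘_)
open import Relation.Nullary using (¬_; does; yes; no)
open import Relation.Binary.PropositionalEquality
  using (_≡_; _≢_; refl; sym; trans; cong; cong₂; subst; module ≡-Reasoning)

open ≡-Reasoning

sum-tabulate-punchIn : ∀ {n} (f : Fin (suc n) → ℕ) i →
                       sum (tabulate f) ≡ f i + sum (tabulate (f ∘ punchIn i))
sum-tabulate-punchIn f zero = refl
sum-tabulate-punchIn {suc n} f (suc i) = begin
  f zero + sum (tabulate (f ∘ suc))
    ≡⟨ cong (f zero +_) (sum-tabulate-punchIn (f ∘ suc) i) ⟩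
  f zero + (f (suc i) + rest)      ≡⟨ sym (+-assoc (f zero) _ rest) ⟩
  f zero + f (suc i) + rest        ≡⟨ cong (_+ rest) (+-comm (f zero) _) ⟩
  f (suc i) + f zero + rest        ≡⟨ +-assoc (f (suc i)) _ rest ⟩
  f (suc i) + sum (tabulate (f ∘ punchIn (suc i))) ∎
  where
  rest : ℕ
  rest = sum (tabulate (f ∘ suc ∘ punchIn i))

sum-tabulate-≤ : ∀ {n} (f : Fin n → ℕ) → (∀ i → f i ≤ 1) → sum (tabulate f) ≤ n
sum-tabulate-≤ {zero}  f f≤1 = z≤n
sum-tabulate-≤ {suc n} f f≤1 with f zero | f≤1 zero
... | 0 | z≤n     = m≤n⇒m≤1+n (sum-tabulate-≤ (f ∘ suc) (f≤1 ∘ suc))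
... | 1 | s≤s z≤n = s≤s (sum-tabulate-≤ (f ∘ suc) (f≤1 ∘ suc))

sum-tabulate-< : ∀ {n} (f : Fin n → ℕ) → (∀ i → f i ≤ 1) →
                 ∀ i → f i ≡ 0 → sum (tabulate f) < n
sum-tabulate-< {suc n} f f≤1 i fi≡0 = subst (_< suc n) (sym sum≡rest) (s≤s rest≤n)
  where
  rest : ℕ
  rest = sum (tabulate (f ∘ punchIn i))

  sum≡rest : sum (tabulate f) ≡ rest
  sum≡rest = trans (sum-tabulate-punchIn f i) (cong (_+ rest) fi≡0)

  rest≤n : rest ≤ n
  rest≤n = sum-tabulate-≤ (f ∘ punchIn i) (f≤1 ∘ punchIn i)

indicator≤1 : (b : Bool) → (if b then 1 else 0) ≤ 1
indicator≤1 true  = s≤s z≤n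
indicator≤1 false = z≤n

full-degree⇒adj : ∀ {n} (G : Graph n) y → degree G y ≡ n ∸ 1 →
                  ∀ z → z ≢ y → adj G y z ≡ true
full-degree⇒adj {suc m} G y deg z z≢y = ¬-not nonadjacent⇒⊥
  where
  edge : Fin (suc m) → ℕ
  edge w = if adj G y w then 1 else 0

  no-loop : edge y ≡ 0
  no-loop = cong (λ b → if b then 1 else 0) (irrefl G y)

  degree-without-y : degree G y ≡ sum (tabulate (edge ∘ punchIn y))
  degree-without-y = begin
    sum (map edge (tabulate (λ w → w)))         ≡⟨ cong sum (map-tabulate (λ w → w) edge) ⟩
    sum (tabulate edge)                         ≡⟨ sum-tabulate-punchIn edge y ⟩
    edge y + sum (tabulate (edge ∘ punchIn y))  ≡⟨ cong (_+ sum (tabulate (edge ∘ punchIn y))) no-loop ⟩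
    sum (tabulate (edge ∘ punchIn y))           ∎

  nonadjacent⇒⊥ : adj G y z ≢ false
  nonadjacent⇒⊥ yz =
    <-irrefl (trans (sym degree-without-y) deg)
      (sum-tabulate-< (edge ∘ punchIn y) (indicator≤1 ∘ adj G y ∘ punchIn y)
                      (punchOut (z≢y ∘ sym))
                      (trans (cong edge (punchIn-punchOut (z≢y ∘ sym)))
                             (cong (λ b → if b then 1 else 0) yz)))

-- With adj G y x this says N[x] ⊆ N[y].
Dominates : ∀ {n} → Graph n → Fin n → Fin n → Set
Dominates G y x = ∀ z → z ≢ y → adj G x z ≡ true → adj G y z ≡ true

DominatedByNeighbour : ∀ {n} → Graph n → Fin n → Set
DominatedByNeighbour G x = ∃[ y ] adj G y x ≡ true × Dominates G y x

IsVertexDeletion : ∀ {m} → Graph m → Graph (suc m) → Fin (suc m) → Set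
IsVertexDeletion G′ G x = ∀ a b → adj G′ a b ≡ adj G (punchIn x a) (punchIn x b)

lookup-removeAt : ∀ {A : Set} {m} (xs : Vec A (suc m)) i j →
                  lookup (removeAt xs i) j ≡ lookup xs (punchIn i j)
lookup-removeAt xs i j = begin
  lookup (removeAt xs i) j                  ≡⟨ cong (lookup (removeAt xs i)) (sym (punchOut-punchIn i)) ⟩
  lookup (removeAt xs i) (punchOut i≢pᵢj)  ≡⟨ removeAt-punchOut xs i≢pᵢj ⟩
  lookup xs (punchIn i j)                   ∎
  where
  i≢pᵢj : i ≢ punchIn i j
  i≢pᵢj = punchInᵢ≢i i j ∘ sym

inducesMember-vertexDeletion : ∀ ℋ {m} (G′ : Graph m) (G : Graph (suc m)) {x} →
  IsVertexDeletion G′ G x → ∀ {S} → x ∉ S → InducesMember ℋ G S →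
  InducesMember ℋ G′ (removeAt S x)
inducesMember-vertexDeletion ℋ {m} G′ G {x} G′≡G−x {S} x∉S
  (k , H , H∈ℋ , f , (f-inj , f-adj) , f-onto , f∈S) =
  k , H , H∈ℋ , f′ , (f′-inj , f′-adj) , f′-onto , f′∈S′
  where
  x≢f : ∀ i → x ≢ f i
  x≢f i x≡fi = x∉S (subst (_∈ S) (sym x≡fi) (f∈S i))

  f′ : Fin k → Fin m
  f′ i = punchOut (x≢f i)

  punchIn-f′ : ∀ i → punchIn x (f′ i) ≡ f i
  punchIn-f′ i = punchIn-punchOut (x≢f i)

  f′-inj : ∀ {i j} → f′ i ≡ f′ j → i ≡ j
  f′-inj {i} {j} = f-inj ∘ punchOut-injective (x≢f i) (x≢f j)

  f′-adj : ∀ i j → adj G′ (f′ i) (f′ j) ≡ adj H i j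
  f′-adj i j = begin
    adj G′ (f′ i) (f′ j)                       ≡⟨ G′≡G−x (f′ i) (f′ j) ⟩
    adj G (punchIn x (f′ i)) (punchIn x (f′ j)) ≡⟨ cong₂ (adj G) (punchIn-f′ i) (punchIn-f′ j) ⟩
    adj G (f i) (f j)                          ≡⟨ f-adj i j ⟩
    adj H i j                                  ∎

  f′-onto : ∀ v → v ∈ removeAt S x → ∃[ i ] f′ i ≡ v
  f′-onto v v∈S′
    with f-onto (punchIn x v) (lookup⇒[]= _ S (trans (sym (lookup-removeAt S x v)) ([]=⇒lookup v∈S′)))
  ... | i , fi≡pₓv = i , trans (punchOut-cong x fi≡pₓv) (punchOut-punchIn x)

  f′∈S′ : ∀ i → f′ i ∈ removeAt S x
  f′∈S′ i = lookup⇒[]= _ _ (trans (removeAt-punchOut S (x≢f i)) ([]=⇒lookup (f∈S i)))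

module _ {m} (G : Graph (suc m)) {y x} (y≽x : Dominates G y x) where

  private
    -- The disjuncts that contract adds to adjacency: edges from the merged vertex y to N(x).
    no-new-edge : ∀ c d → c ≢ d → adj G c d ≡ false → (does (c ≟ y) ∧ adj G d x) ≡ false
    no-new-edge c d c≢d cd with c ≟ y
    ... | no _     = refl
    ... | yes refl = ¬-not λ dx →
      true≢false (trans (sym (y≽x d (c≢d ∘ sym) (trans (adj-sym G x d) dx))) cd)
      where
      true≢false : true ≢ false
      true≢false ()

  contract-dominated : (e : adj G y x ≡ true) → IsVertexDeletion (contract G y x e) G x
  contract-dominated e a b with a ≟ b
  ... | yes refl = sym (irrefl G (punchIn x a))
  ... | no a≢b with adj G (punchIn x a) (punchIn x b) in ab
  ...   | true  = refl
  ...   | false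
    rewrite no-new-edge (punchIn x a) (punchIn x b) (a≢b ∘ punchIn-injective x a b) ab
          | no-new-edge (punchIn x b) (punchIn x a) (a≢b ∘ sym ∘ punchIn-injective x b a)
                        (trans (adj-sym G _ _) ab) = refl

critical⇒¬dominatedByNeighbour : ∀ ℋ {n} (G : Graph n) → CriticallyHExist ℋ G →
  ∀ S → InducesMember ℋ G S → ∀ x → x ∉ S → ¬ DominatedByNeighbour G x
critical⇒¬dominatedByNeighbour ℋ {suc m} G (_ , contractions-free) S S∈ℋ x x∉S (y , yx , y≽x) =
  contractions-free y x yx
    (removeAt S x ,
     inducesMember-vertexDeletion ℋ (contract G y x yx) G (contract-dominated G y≽x yx) x∉S S∈ℋ)

nbhdSingleton⇒dominatedByNeighbour : ∀ {n} (G : Graph n) {x} →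
  NbhdSingleton G x → DominatedByNeighbour G x
nbhdSingleton⇒dominatedByNeighbour G {x} (y , N≡y) =
  y , trans (adj-sym G y x) (proj₂ (N≡y y) refl) ,
  λ z z≢y xz → ⊥-elim (z≢y (proj₁ (N≡y z) xz))

nbhdEdge⇒dominatedByNeighbour : ∀ {n} (G : Graph n) {x} →
  NbhdEdge G x → DominatedByNeighbour G x
nbhdEdge⇒dominatedByNeighbour G {x} (y , w , _ , yw , N≡yw) =
  y , trans (adj-sym G y x) (proj₂ (N≡yw y) (inj₁ refl)) ,
  λ z z≢y xz → y∼ (proj₁ (N≡yw z) xz) z≢y
  where
  y∼ : ∀ {z} → z ≡ y ⊎ z ≡ w → z ≢ y → adj G y z ≡ true
  y∼ (inj₁ z≡y)  z≢y = ⊥-elim (z≢y z≡y)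
  y∼ (inj₂ refl) _   = yw

nbhdP3orC3⇒dominatedByNeighbour : ∀ {n} (G : Graph n) {x} →
  NbhdP3orC3 G x → DominatedByNeighbour G x
nbhdP3orC3⇒dominatedByNeighbour G {x} (a , b , c , _ , _ , _ , N≡abc , P₃⊎C₃) =
  b , trans (adj-sym G b x) (proj₂ (N≡abc b) (inj₂ (inj₁ refl))) ,
  λ z z≢b xz → b∼ (proj₁ (N≡abc z) xz) z≢b
  where
  ab : adj G a b ≡ true
  ab = [ proj₁ , proj₁ ]′ P₃⊎C₃

  bc : adj G b c ≡ true
  bc = [ proj₁ ∘ proj₂ , proj₁ ∘ proj₂ ]′ P₃⊎C₃

  b∼ : ∀ {z} → z ≡ a ⊎ z ≡ b ⊎ z ≡ c → z ≢ b → adj G b z ≡ true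
  b∼ (inj₁ refl)        _   = trans (adj-sym G b a) ab
  b∼ (inj₂ (inj₁ z≡b))  z≢b = ⊥-elim (z≢b z≡b)
  b∼ (inj₂ (inj₂ refl)) _   = bc

adjToDominating⇒dominatedByNeighbour : ∀ {n} (G : Graph n) {x} →
  AdjToDominating G x → DominatedByNeighbour G x
adjToDominating⇒dominatedByNeighbour G {x} (y , xy , deg) =
  y , trans (adj-sym G y x) xy , λ z z≢y _ → full-degree⇒adj G y deg z z≢y

corollary12 : (ℋ : GraphFamily) {n : ℕ} (G : Graph n) → CriticallyHExist ℋ G →
    (S : Subset n) → InducesMember ℋ G S →
    ∀ x → x ∉ S →
      ¬ (NbhdSingleton G x ⊎ NbhdEdge G x ⊎ NbhdP3orC3 G x ⊎ AdjToDominating G x)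
corollary12 ℋ G critical S S∈ℋ x x∉S =
  critical⇒¬dominatedByNeighbour ℋ G critical S S∈ℋ x x∉S ∘
    [ nbhdSingleton⇒dominatedByNeighbour G
    , [ nbhdEdge⇒dominatedByNeighbour G
      , [ nbhdP3orC3⇒dominatedByNeighbour G
        , adjToDominating⇒dominatedByNeighbour G ]′ ]′ ]′
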